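{- Let $L$ be a large even integer with $\sqrt L$ an integer, let $V=\{v_1,v_2,v_3,v_4\}$ with all degree bounds $1$, and write a unit-weight job as (source, destination, size, release time). Let $\mathcal S_1$ consist of $\sqrt L$ jobs $(v_1,v_2,1,1)$, $\mathcal S_2$ of $\sqrt L$ jobs $(v_3,v_2,1,1)$, $\mathcal S_3=\{(v_3,v_4,1,\sqrt L+i): i\in[L]\}$, $\mathcal S_4=\{(v_1,v_4,1,\sqrt L+i): i\in[L]\}$, and let the instance be $\mathcal T_1=\mathcal S_1\cup\mathcal S_2\cup\mathcal S_3$ with probability $1/2$ and $\mathcal T_2=\mathcal S_1\cup\mathcal S_2\cup\mathcal S_4$ with probability $1/2$. Let $\mathcal A$ be any deterministic online algorithm (speed $1$). Then with probability at least $1/2$, for every $t\in\{\sqrt L+1,\sqrt L+2,\dots,L+\sqrt L\}$, at time $t$ there are at least $\sqrt L/2$ jobs that have been released but not yet finished by $\mathcal A$.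
   Context: Time is slotted. In each slot a schedule processes a set of released uncompleted unit-size jobs forming a matching on $V$ (each node is an endpoint of at most one processed job); a processed job is completed. An online algorithm learns of a job only at its release time. -}

module Defs where

open import Data.Nat using (ℕ; zero; suc; _+_; _*_; _≤_; _<_; _≤?_)
open import Data.Fin using (Fin)
open import Data.List using (List; []; _∷_; _++_; replicate; map; upTo; filter; length)
open import Data.List.Membership.Propositional using (_∈_)
open import Data.List.Relation.Unary.All using (All)
open import Data.List.Relation.Unary.AllPairs using (AllPairs)
open import Data.List.Relation.Unary.Unique.Propositional using (Unique)
open import Data.Maybe using (Maybe; just; nothing)
open import Data.Product using (_×_; ∃-syntax)
open import Relation.Binary.PropositionalEquality using (_≡_; _≢_)
open import Relation.Nullary using (¬_)

-- A unit-size, unit-weight job: (source, destination, release time).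
-- Nodes v1,v2,v3,v4 are Fin 4 elements 0,1,2,3.
record Job : Set where
  constructor job
  field
    src : Fin 4
    dst : Fin 4
    rel : ℕ
open Job public

-- An instance is a list of jobs; a job's identity is its position in the list.
-- Instances below are listed in order of nondecreasing release time.
Instance : Set
Instance = List Job

at : Instance → ℕ → Maybe Job
at [] _ = nothing
at (x ∷ xs) zero = just x
at (x ∷ xs) (suc k) = at xs k

visible : ℕ → Instance → Instance
visible t I = filter (λ j → rel j ≤? t) I

-- A deterministic online algorithm: at slot t it sees only t and the jobs
-- released so far (its own past decisions are determined by these), and
-- outputs the list of (positions of) jobs it processes in slot t.
Alg : Set
Alg = ℕ → Instance → List ℕ

choice : Alg → Instance → ℕ → List ℕ
choice A I t = A t (visible t I)

CompletedBy : Alg → Instance → ℕ → ℕ → Set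
CompletedBy A I k t = ∃[ u ] (u ≤ t × k ∈ choice A I u)

CompletedBefore : Alg → Instance → ℕ → ℕ → Set
CompletedBefore A I k t = ∃[ u ] (u < t × k ∈ choice A I u)

NodeDisjoint : Job → Job → Set
NodeDisjoint j j' = (src j ≢ src j') × (src j ≢ dst j') × (dst j ≢ src j') × (dst j ≢ dst j')

-- Slot t of A on I is feasible: processed jobs are existing, released,
-- uncompleted, distinct jobs forming a matching (all degree bounds 1).
ValidSlot : Alg → Instance → ℕ → Set
ValidSlot A I t =
  All (λ k → ∃[ j ] (at I k ≡ just j × rel j ≤ t × ¬ CompletedBefore A I k t)) (choice A I t)
  × AllPairs (λ k k' → k ≢ k' × (∀ j j' → at I k ≡ just j → at I k' ≡ just j' → NodeDisjoint j j'))
             (choice A I t)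

ValidOn : Alg → Instance → Set
ValidOn A I = ∀ t → ValidSlot A I t

-- at time t (after slot t) at least m jobs are released but not finished by A
BacklogAtLeast : Alg → Instance → ℕ → ℕ → Set
BacklogAtLeast A I t m =
  ∃[ ks ] (Unique ks × m ≤ length ks ×
           All (λ k → ∃[ j ] (at I k ≡ just j × rel j ≤ t × ¬ CompletedBy A I k t)) ks)

-- The instance family, with s = √L and L = s * s.
v1 v2 v3 v4 : Fin 4
v1 = Fin.zero
v2 = Fin.suc Fin.zero
v3 = Fin.suc (Fin.suc Fin.zero)
v4 = Fin.suc (Fin.suc (Fin.suc Fin.zero))

S1 S2 S3 S4 T1 T2 : ℕ → Instance
S1 s = replicate s (job v1 v2 1)
S2 s = replicate s (job v3 v2 1)
-- i ∈ [L] = {1,…,L}: release time s + i = s + suc i' for i' ∈ {0,…,L-1}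
S3 s = map (λ i → job v3 v4 (s + suc i)) (upTo (s * s))
S4 s = map (λ i → job v1 v4 (s + suc i)) (upTo (s * s))
T1 s = S1 s ++ S2 s ++ S3 s
T2 s = S1 s ++ S2 s ++ S4 s

PendingThroughout : Alg → Instance → ℕ → Set
PendingThroughout A I s =
  ∀ t → suc s ≤ t → t ≤ s * s + s → ∃[ m ] (s ≤ 2 * m × BacklogAtLeast A I t m)

module Submission where

-- Two counting facts about a set C of pairwise conflicting jobs (no two of
-- them fit into one matching) drive the argument: every slot finishes at most
-- one job of C, so (drain) at most t jobs of C are finished by time t; and
-- (sustain) if one new job of C is released in every slot, the number of
-- pending jobs of C never decreases.
--
-- Phase 1: S1 ∪ S2 all end in v2, so by time s at most s of its 2s jobs are
-- finished, i.e. p₁ + p₂ ≥ s, where p₂ counts the pending S2 jobs in T1 and p₁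
-- the pending S1 jobs, the latter being equal in T1 and T2 because the two
-- instances look identical up to time s.  Phase 2: in T1 the jobs S2 ∪ S3 all
-- start at v3, in T2 the jobs S1 ∪ S4 all start at v1; sustain keeps p₂
-- (resp. p₁) jobs pending throughout the second wave.

open import Defs
open import Data.Nat using (ℕ; _*_; _≤_)
open import Data.Nat.Divisibility using (_∣_)
open import Data.Product using (∃-syntax)
open import Data.Sum using (_⊎_)

open import Level using (Level)
open import Data.Bool using (true; false)
open import Data.Nat using (zero; suc; _+_; _∸_; _<_; z≤n; s≤s; z<s; _≤?_)
open import Data.Nat.Properties
open import Data.Fin using (Fin)
open import Data.List using (List; []; _∷_; _++_; [_]; replicate; applyUpTo; upTo; map; filter; length)
open import Data.List.Properties
  using (length-++; length-applyUpTo; applyUpTo-∷ʳ; map-upTo; ++-assoc; ++-identityʳ;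
         filter-++; filter-all; filter-none; filter-accept; filter-≐)
open import Data.List.Membership.Propositional using (_∈_)
open import Data.List.Membership.DecPropositional _≟_ using (_∈?_)
open import Data.List.Membership.Propositional.Properties
  using (∈-++⁻; ∈-++⁺ˡ; ∈-++⁺ʳ; ∈-filter⁻; ∈-applyUpTo⁺; ∈-applyUpTo⁻)
open import Data.List.Relation.Unary.Any using (here; there)
open import Data.List.Relation.Unary.All as All using (All; []; _∷_)
import Data.List.Relation.Unary.All.Properties as All
open import Data.List.Relation.Unary.AllPairs using (AllPairs; []; _∷_)
open import Data.List.Relation.Unary.Unique.Propositional using (Unique)
import Data.List.Relation.Unary.Unique.Propositional.Properties as Unique
open import Data.Maybe using (just)
open import Data.Maybe.Properties using (just-injective)
open import Data.Product using (_×_; _,_; proj₁; proj₂)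
open import Data.Sum using (inj₁; inj₂)
import Data.Sum as Sum
open import Data.Empty using (⊥-elim)
open import Relation.Nullary using (¬_; Dec; yes; no; does; map′; ¬?)
open import Relation.Unary using (Pred; Decidable)
open import Relation.Binary.PropositionalEquality hiding ([_])

private
  variable
    a p q r : Level
    X : Set a

length-filter-∷ : {P : Pred X p} (P? : Decidable P) (x : X) (xs : List X) →
  length (filter P? xs) ≤ length (filter P? (x ∷ xs))
length-filter-∷ P? x xs with does (P? x)
... | true  = n≤1+n _
... | false = ≤-refl

length-filter-cover : {P : Pred X p} {Q : Pred X q} {R : Pred X r}
  (P? : Decidable P) (Q? : Decidable Q) (R? : Decidable R) → (∀ {x} → P x → Q x ⊎ R x) →
  ∀ xs → length (filter P? xs) ≤ length (filter Q? xs) + length (filter R? xs)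
length-filter-cover P? Q? R? cover [] = z≤n
length-filter-cover P? Q? R? cover (x ∷ xs) with ih ← length-filter-cover P? Q? R? cover xs | P? x
... | no _ = ≤-trans ih (+-mono-≤ (length-filter-∷ Q? x xs) (length-filter-∷ R? x xs))
... | yes px with cover px
...   | inj₁ qx = begin
        suc (length (filter P? xs))                                      ≤⟨ s≤s (≤-trans ih (+-monoʳ-≤ _ (length-filter-∷ R? x xs))) ⟩
        suc (length (filter Q? xs)) + length (filter R? (x ∷ xs))        ≡⟨ cong (λ ys → length ys + _) (filter-accept Q? qx) ⟨
        length (filter Q? (x ∷ xs)) + length (filter R? (x ∷ xs))        ∎
  where open ≤-Reasoning
...   | inj₂ rx = begin
        suc (length (filter P? xs))                                      ≤⟨ s≤s (≤-trans ih (+-monoˡ-≤ _ (length-filter-∷ Q? x xs))) ⟩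
        suc (length (filter Q? (x ∷ xs)) + length (filter R? xs))        ≡⟨ +-suc _ _ ⟨
        length (filter Q? (x ∷ xs)) + suc (length (filter R? xs))        ≡⟨ cong (λ ys → _ + length ys) (filter-accept R? rx) ⟨
        length (filter Q? (x ∷ xs)) + length (filter R? (x ∷ xs))        ∎
  where open ≤-Reasoning

unique-constant-length≤1 : {xs : List X} → Unique xs → (∀ {x y} → x ∈ xs → y ∈ xs → x ≡ y) →
  length xs ≤ 1
unique-constant-length≤1 {xs = []}        _                 _     = z≤n
unique-constant-length≤1 {xs = _ ∷ []}    _                 _     = ≤-refl
unique-constant-length≤1 {xs = _ ∷ _ ∷ _} ((x≢y ∷ _) ∷ _) const = ⊥-elim (x≢y (const (here refl) (there (here refl))))

allPairs-∈ : {R : X → X → Set r} {xs : List X} {x y : X} →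
  AllPairs R xs → x ∈ xs → y ∈ xs → x ≡ y ⊎ R x y ⊎ R y x
allPairs-∈ (_  ∷ _)  (here refl) (here refl) = inj₁ refl
allPairs-∈ (Rx ∷ _)  (here refl) (there y∈) = inj₂ (inj₁ (All.lookup Rx y∈))
allPairs-∈ (Rx ∷ _)  (there x∈) (here refl) = inj₂ (inj₂ (All.lookup Rx x∈))
allPairs-∈ (_  ∷ ps) (there x∈) (there y∈) = allPairs-∈ ps x∈ y∈

HasJob : Instance → (Job → Set) → ℕ → Set
HasJob I Q k = ∃[ j ] (at I k ≡ just j × Q j)

has-job-map : ∀ I {P Q : Job → Set} {k} → (∀ {j} → P j → Q j) → HasJob I P k → HasJob I Q k
has-job-map I P⇒Q (j , ↦j , Pj) = j , ↦j , P⇒Q Pj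

Released : Instance → ℕ → ℕ → Set
Released I t = HasJob I (λ j → rel j ≤ t)

-- Completion by time t is decidable: only the slots 0,…,t have to be inspected.
completed? : (A : Alg) (I : Instance) (t k : ℕ) → Dec (CompletedBy A I k t)
completed? A I t k =
  map′ (λ (u , u<1+t , k∈) → u , ≤-pred u<1+t , k∈) (λ (u , u≤t , k∈) → u , s≤s u≤t , k∈)
       (anyUpTo? (λ u → k ∈? choice A I u) (suc t))

pending : Alg → Instance → ℕ → List ℕ → List ℕ
pending A I t = filter (λ k → ¬? (completed? A I t k))

completed-suc : ∀ {A I k t} → CompletedBy A I k (suc t) → CompletedBy A I k t ⊎ k ∈ choice A I (suc t)
completed-suc (u , u≤1+t , k∈) with m≤n⇒m<n∨m≡n u≤1+t
... | inj₁ u<1+t = inj₁ (u , ≤-pred u<1+t , k∈)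
... | inj₂ refl  = inj₂ k∈

unfinished-before-release : ∀ {A I k j t} → ValidOn A I → at I k ≡ just j → t < rel j →
  ¬ CompletedBy A I k t
unfinished-before-release valid k↦j t<rel (u , u≤t , k∈)
  with All.lookup (proj₁ (valid u)) k∈
... | j′ , k↦j′ , rel≤u , _ rewrite just-injective (trans (sym k↦j) k↦j′) =
  <⇒≱ t<rel (≤-trans rel≤u u≤t)

pending-unfinished : ∀ {A I t C} → All (λ k → ¬ CompletedBy A I k t) C → pending A I t C ≡ C
pending-unfinished {A} {I} {t} = filter-all (λ k → ¬? (completed? A I t k))

length-pending-snoc : ∀ {A I t} C {k} → ¬ CompletedBy A I k t →
  length (pending A I t (C ++ [ k ])) ≡ length (pending A I t C) + 1
length-pending-snoc {A} {I} {t} C {k} unfinished = begin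
  length (pending A I t (C ++ [ k ]))                   ≡⟨ cong length (filter-++ unfinished? C [ k ]) ⟩
  length (pending A I t C ++ pending A I t [ k ])       ≡⟨ length-++ (pending A I t C) ⟩
  length (pending A I t C) + length (pending A I t [ k ]) ≡⟨ cong (λ ks → _ + length ks) (filter-accept unfinished? unfinished) ⟩
  length (pending A I t C) + 1                          ∎
  where
  open ≡-Reasoning
  unfinished? = λ k → ¬? (completed? A I t k)

pending-cong : ∀ {A I I′ t} → (∀ {u} → u ≤ t → choice A I u ≡ choice A I′ u) →
  ∀ C → pending A I t C ≡ pending A I′ t C
pending-cong {A} {I} {I′} {t} agree =
  filter-≐ (λ k → ¬? (completed? A I t k)) (λ k → ¬? (completed? A I′ t k))
           (transfer {I} {I′} agree , transfer {I′} {I} (λ u≤t → sym (agree u≤t)))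
  where
  transfer : ∀ {J J′ k} → (∀ {u} → u ≤ t → choice A J u ≡ choice A J′ u) →
    ¬ CompletedBy A J k t → ¬ CompletedBy A J′ k t
  transfer {k = k} same unfinished (u , u≤t , k∈) = unfinished (u , u≤t , subst (k ∈_) (sym (same u≤t)) k∈)

backlog : ∀ {A I t C m} → Unique C → All (Released I t) C → m ≤ length (pending A I t C) →
  BacklogAtLeast A I t m
backlog {A} {I} {t} {C} C-unique released m≤ =
  pending A I t C , Unique.filter⁺ _ C-unique , m≤ , All.tabulate pending-job
  where
  pending-job : ∀ {k} → k ∈ pending A I t C → ∃[ j ] (at I k ≡ just j × rel j ≤ t × ¬ CompletedBy A I k t)
  pending-job k∈ with ∈-filter⁻ (λ k → ¬? (completed? A I t k)) k∈
  ... | k∈C , unfinished with All.lookup released k∈C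
  ...   | j , k↦j , rel≤t = j , k↦j , rel≤t , unfinished

Conflicting : Instance → List ℕ → Set
Conflicting I C = ∀ {x y} → x ∈ C → y ∈ C → ∀ {j j′} → at I x ≡ just j → at I y ≡ just j′ →
  ¬ NodeDisjoint j j′

common-endpoint-conflicting : ∀ {I C v} (end : Job → Fin 4) →
  (∀ {j j′} → NodeDisjoint j j′ → end j ≢ end j′) → All (HasJob I (λ j → end j ≡ v)) C →
  Conflicting I C
common-endpoint-conflicting end disjoint-ends common x∈ y∈ x↦j y↦j′ disjoint
  with All.lookup common x∈ | All.lookup common y∈
... | _ , x↦ , endx | _ , y↦ , endy
  rewrite just-injective (trans (sym x↦) x↦j) | just-injective (trans (sym y↦) y↦j′) =
  disjoint-ends disjoint (trans endx (sym endy))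

conflicting-⊆ : ∀ {I C D} → (∀ {x} → x ∈ C → x ∈ D) → Conflicting I D → Conflicting I C
conflicting-⊆ C⊆D conflicting x∈ y∈ = conflicting (C⊆D x∈) (C⊆D y∈)

at-most-one-per-slot : ∀ {A I t C} → ValidSlot A I t → Unique C → Conflicting I C →
  length (filter (_∈? choice A I t) C) ≤ 1
at-most-one-per-slot {A} {I} {t} {C} (released , matching) C-unique conflicting =
  unique-constant-length≤1 (Unique.filter⁺ _ C-unique) same
  where
  same : ∀ {x y} → x ∈ filter (_∈? choice A I t) C → y ∈ filter (_∈? choice A I t) C → x ≡ y
  same x∈ y∈ with ∈-filter⁻ (_∈? choice A I t) x∈ | ∈-filter⁻ (_∈? choice A I t) y∈
  ... | x∈C , x∈ch | y∈C , y∈ch with All.lookup released x∈ch | All.lookup released y∈ch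
  ...   | j , x↦j , _ | j′ , y↦j′ , _ with allPairs-∈ matching x∈ch y∈ch
  ...     | inj₁ x≡y            = x≡y
  ...     | inj₂ (inj₁ (_ , d)) = ⊥-elim (conflicting x∈C y∈C x↦j y↦j′ (d j j′ x↦j y↦j′))
  ...     | inj₂ (inj₂ (_ , d)) = ⊥-elim (conflicting y∈C x∈C y↦j′ x↦j (d j′ j y↦j′ x↦j))

slot-drain : ∀ {A I t C} → ValidSlot A I (suc t) → Unique C → Conflicting I C →
  length (pending A I t C) ≤ length (pending A I (suc t) C) + 1
slot-drain {A} {I} {t} {C} valid C-unique conflicting =
  ≤-trans (length-filter-cover (λ k → ¬? (completed? A I t k)) (λ k → ¬? (completed? A I (suc t) k))
                               (_∈? choice A I (suc t)) still-pending-or-processed C)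
          (+-monoʳ-≤ _ (at-most-one-per-slot {A} {I} {suc t} {C} valid C-unique conflicting))
  where
  still-pending-or-processed : ∀ {k} → ¬ CompletedBy A I k t →
    ¬ CompletedBy A I k (suc t) ⊎ k ∈ choice A I (suc t)
  still-pending-or-processed {k} unfinished with completed? A I (suc t) k
  ... | no  unfinished′ = inj₁ unfinished′
  ... | yes completed with completed-suc {A} {I} completed
  ...   | inj₁ completed-before = ⊥-elim (unfinished completed-before)
  ...   | inj₂ processed        = inj₂ processed

drain : ∀ {A I C} → ValidOn A I → Unique C → Conflicting I C →
  ∀ t → length (pending A I 0 C) ≤ length (pending A I t C) + t
drain valid C-unique conflicting zero = ≤-reflexive (sym (+-identityʳ _))
drain {A} {I} {C} valid C-unique conflicting (suc t) = begin
  length (pending A I 0 C)                   ≤⟨ drain {A} {I} {C} valid C-unique conflicting t ⟩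
  length (pending A I t C) + t               ≤⟨ +-monoˡ-≤ t (slot-drain {A} {I} {t} {C} (valid (suc t)) C-unique conflicting) ⟩
  length (pending A I (suc t) C) + 1 + t     ≡⟨ +-assoc _ 1 t ⟩
  length (pending A I (suc t) C) + suc t     ∎
  where open ≤-Reasoning

-- block a n lists the positions a, a+1, …, a+n-1; the jobs of S1, S2 and of
-- the second wave occupy the blocks 0 s, s s and (s+s) (s*s) respectively.
block : ℕ → ℕ → List ℕ
block a n = applyUpTo (a +_) n

∈-block⁻ : ∀ {a n k} → k ∈ block a n → ∃[ i ] (i < n × k ≡ a + i)
∈-block⁻ {a} = ∈-applyUpTo⁻ (a +_)

block-⊆ : ∀ {a d n k} → d ≤ n → k ∈ block a d → k ∈ block a n
block-⊆ {a} d≤n k∈ with ∈-block⁻ k∈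
... | i , i<d , refl = ∈-applyUpTo⁺ (a +_) (<-≤-trans i<d d≤n)

block-unique : ∀ a n → Unique (block a n)
block-unique a n = Unique.applyUpTo⁺₁ (a +_) n (λ i<j _ eq → <⇒≢ i<j (+-cancelˡ-≡ a _ _ eq))

blocks-unique : ∀ {a m b n} → a + m ≤ b → Unique (block a m ++ block b n)
blocks-unique {a} {m} {b} {n} a+m≤b = Unique.++⁺ (block-unique a m) (block-unique b n) disjoint
  where
  disjoint : ∀ {k} → ¬ (k ∈ block a m × k ∈ block b n)
  disjoint (k∈₁ , k∈₂) with ∈-block⁻ k∈₁ | ∈-block⁻ k∈₂
  ... | i , i<m , refl | i′ , _ , a+i≡b+i′ =
    <⇒≱ (<-≤-trans (+-monoʳ-< a i<m) a+m≤b) (≤-trans (m≤m+n b i′) (≤-reflexive (sym a+i≡b+i′)))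

block-snoc : ∀ a n → block a (suc n) ≡ block a n ++ [ a + n ]
block-snoc a n = sym (applyUpTo-∷ʳ (a +_) n)

-- Sustain: an old block of jobs and a wave of new jobs, the i-th of which is
-- released at time t₀+1+i, all pairwise conflicting.  Each slot of the wave
-- finishes at most one of them while releasing a new one, so the number of
-- pending jobs never drops below the number of old jobs pending at time t₀.
module Sustain {A : Alg} {I : Instance} (valid : ValidOn A I) {t₀ b m base n : ℕ}
  (b+m≤base : b + m ≤ base) (conflicting : Conflicting I (block b m ++ block base n))
  (wave-release : ∀ {i} → i < n → HasJob I (λ j → rel j ≡ t₀ + suc i) (base + i)) where

  active : ℕ → List ℕ
  active d = block b m ++ block base d

  active-unique : ∀ d → Unique (active d)
  active-unique d = blocks-unique {n = d} b+m≤base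

  active-conflicting : ∀ {d} → d ≤ n → Conflicting I (active d)
  active-conflicting {d} d≤n = conflicting-⊆ {I} {active d} {active n} active⊆ conflicting
    where
    active⊆ : ∀ {k} → k ∈ active d → k ∈ active n
    active⊆ k∈ with ∈-++⁻ (block b m) k∈
    ... | inj₁ k∈old  = ∈-++⁺ˡ k∈old
    ... | inj₂ k∈wave = ∈-++⁺ʳ (block b m) (block-⊆ d≤n k∈wave)

  active-snoc : ∀ d → active (suc d) ≡ active d ++ [ base + d ]
  active-snoc d = trans (cong (block b m ++_) (block-snoc base d)) (sym (++-assoc (block b m) _ _))

  newest-unfinished : ∀ {d} → d < n → ¬ CompletedBy A I (base + d) (t₀ + d)
  newest-unfinished {d} d<n with wave-release d<n
  ... | j , ↦j , rel≡ = unfinished-before-release {A} {I} valid ↦j (≤-reflexive (sym (trans rel≡ (+-suc t₀ d))))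

  old : ℕ
  old = length (pending A I t₀ (block b m))

  sustain : ∀ d → d ≤ n → old ≤ length (pending A I (t₀ + d) (active d))
  sustain zero _ = ≤-reflexive (cong length (cong₂ (pending A I) (sym (+-identityʳ t₀)) (sym (++-identityʳ (block b m)))))
  sustain (suc d) 1+d≤n = +-cancelʳ-≤ 1 _ _ (begin
    old + 1                                          ≤⟨ +-monoˡ-≤ 1 (sustain d (<⇒≤ 1+d≤n)) ⟩
    length (pending A I t (active d)) + 1            ≡⟨ length-pending-snoc {A} {I} (active d) (newest-unfinished 1+d≤n) ⟨
    length (pending A I t (active d ++ [ base + d ])) ≡⟨ cong (λ C → length (pending A I t C)) (active-snoc d) ⟨
    length (pending A I t (active (suc d)))          ≤⟨ slot-drain {A} {I} {t} (valid (suc t)) (active-unique (suc d)) (active-conflicting 1+d≤n) ⟩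
    length (pending A I (suc t) (active (suc d))) + 1 ≡⟨ cong (λ T → length (pending A I T (active (suc d))) + 1) (+-suc t₀ d) ⟨
    length (pending A I (t₀ + suc d) (active (suc d))) + 1 ∎)
    where
    open ≤-Reasoning
    t = t₀ + d

  active-released : All (Released I t₀) (block b m) → ∀ {d} → d ≤ n → All (Released I (t₀ + d)) (active d)
  active-released old-released {d} d≤n =
    All.++⁺ (All.map (λ (j , ↦j , rel≤t₀) → j , ↦j , ≤-trans rel≤t₀ (m≤m+n t₀ d)) old-released)
            (All.applyUpTo⁺₁ (base +_) d wave-released)
    where
    wave-released : ∀ {i} → i < d → Released I (t₀ + d) (base + i)
    wave-released {i} i<d with wave-release (<-≤-trans i<d d≤n)
    ... | j , ↦j , rel≡ = j , ↦j , ≤-trans (≤-reflexive rel≡) (+-monoʳ-≤ t₀ i<d)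

  throughout : All (Released I t₀) (block b m) → ∀ t → t₀ ≤ t → t ≤ t₀ + n → BacklogAtLeast A I t old
  throughout old-released t t₀≤t t≤t₀+n =
    subst (λ T → BacklogAtLeast A I T old) (m+[n∸m]≡n t₀≤t)
          (backlog {A} {I} (active-unique d) (active-released old-released d≤n) (sustain d d≤n))
    where
    d = t ∸ t₀
    d≤n : d ≤ n
    d≤n = ≤-trans (∸-monoˡ-≤ t₀ t≤t₀+n) (≤-reflexive (m+n∸m≡n t₀ n))

at-replicate : ∀ {n i} (x : Job) (ys : Instance) → i < n → at (replicate n x ++ ys) i ≡ just x
at-replicate {suc n} {zero}  x ys _         = refl
at-replicate {suc n} {suc i} x ys (s≤s i<n) = at-replicate x ys i<n

at-after-replicate : ∀ n (x : Job) (ys : Instance) k → at (replicate n x ++ ys) (n + k) ≡ at ys k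
at-after-replicate zero    x ys k = refl
at-after-replicate (suc n) x ys k = at-after-replicate n x ys k

at-applyUpTo : ∀ (f : ℕ → Job) {n i} → i < n → at (applyUpTo f n) i ≡ just (f i)
at-applyUpTo f {suc n} {zero}  _         = refl
at-applyUpTo f {suc n} {suc i} (s≤s i<n) = at-applyUpTo (λ k → f (suc k)) i<n

-- T1 s and T2 s differ only in the source u (v3 resp. v1) of the second-wave jobs.
Adversary : ℕ → Fin 4 → Instance
Adversary s u = S1 s ++ S2 s ++ map (λ i → job u v4 (s + suc i)) (upTo (s * s))

visible-early : ∀ s u {t} → t ≤ s → visible t (Adversary s u) ≡ visible t (S1 s) ++ visible t (S2 s)
visible-early s u {t} t≤s = begin
  visible t (S1 s ++ S2 s ++ wave)              ≡⟨ filter-++ released? (S1 s) _ ⟩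
  visible t (S1 s) ++ visible t (S2 s ++ wave)   ≡⟨ cong (visible t (S1 s) ++_) (filter-++ released? (S2 s) wave) ⟩
  visible t (S1 s) ++ visible t (S2 s) ++ visible t wave ≡⟨ cong (λ late → visible t (S1 s) ++ visible t (S2 s) ++ late) wave-hidden ⟩
  visible t (S1 s) ++ visible t (S2 s) ++ []    ≡⟨ cong (visible t (S1 s) ++_) (++-identityʳ _) ⟩
  visible t (S1 s) ++ visible t (S2 s)          ∎
  where
  open ≡-Reasoning
  released? = λ j → rel j ≤? t
  wave = map (λ i → job u v4 (s + suc i)) (upTo (s * s))
  wave-hidden : visible t wave ≡ []
  wave-hidden = filter-none released?
    (All.map⁺ (All.universal (λ i → <⇒≱ (≤-<-trans t≤s (m<m+n s z<s))) (upTo (s * s))))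

early-pending-agree : ∀ s A {t} → t ≤ s → ∀ C → pending A (T1 s) t C ≡ pending A (T2 s) t C
early-pending-agree s A {t} t≤s = pending-cong {A} {T1 s} {T2 s} {t} λ u≤t →
  cong (A _) (trans (visible-early s v3 (≤-trans u≤t t≤s)) (sym (visible-early s v1 (≤-trans u≤t t≤s))))

module Adversarial (s : ℕ) (u : Fin 4) where

  I : Instance
  I = Adversary s u

  first-block : All (HasJob I (_≡ job v1 v2 1)) (block 0 s)
  first-block = All.applyUpTo⁺₁ (0 +_) s (λ i<s → _ , at-replicate _ _ i<s , refl)

  second-block : All (HasJob I (_≡ job v3 v2 1)) (block s s)
  second-block = All.applyUpTo⁺₁ (s +_) s λ {i} i<s →
    _ , trans (at-after-replicate s _ _ i) (at-replicate _ _ i<s) , refl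

  wave-job : ∀ {i} → i < s * s → at I ((s + s) + i) ≡ just (job u v4 (s + suc i))
  wave-job {i} i<ss = begin
    at I ((s + s) + i)                     ≡⟨ cong (at I) (+-assoc s s i) ⟩
    at I (s + (s + i))                     ≡⟨ at-after-replicate s _ _ (s + i) ⟩
    at (S2 s ++ wave) (s + i)              ≡⟨ at-after-replicate s _ _ i ⟩
    at wave i                              ≡⟨ cong (λ js → at js i) (map-upTo _ (s * s)) ⟩
    at (applyUpTo (λ k → job u v4 (s + suc k)) (s * s)) i ≡⟨ at-applyUpTo _ i<ss ⟩
    just (job u v4 (s + suc i))            ∎
    where
    open ≡-Reasoning
    wave = map (λ k → job u v4 (s + suc k)) (upTo (s * s))

  early-released : ∀ {b} → All (HasJob I (λ j → rel j ≡ 1)) (block b s) → All (Released I s) (block b s)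
  early-released {b} early = All.tabulate λ k∈ → released (All.lookup early k∈) (∈-block⁻ {b} k∈)
    where
    released : ∀ {k} → HasJob I (λ j → rel j ≡ 1) k → ∃[ i ] (i < s × k ≡ b + i) → Released I s k
    released (j , ↦j , rel≡1) (i , i<s , _) = j , ↦j , subst (_≤ s) (sym rel≡1) (≤-trans (s≤s z≤n) i<s)

  -- Phase 1: the 2s early jobs all end in v2 and none is finished at time 0,
  -- so by time s at least s of them are still pending.
  rush : ∀ {A} → ValidOn A I →
    s ≤ length (pending A I s (block 0 s)) + length (pending A I s (block s s))
  rush {A} valid = +-cancelʳ-≤ s s _ (begin
    s + s                                   ≡⟨ cong₂ _+_ (length-applyUpTo _ s) (length-applyUpTo _ s) ⟨
    length (block 0 s) + length (block s s) ≡⟨ length-++ (block 0 s) ⟨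
    length early                            ≡⟨ cong length (pending-unfinished {A} {I} unstarted) ⟨
    length (pending A I 0 early)            ≤⟨ drain {A} {I} valid (blocks-unique {n = s} ≤-refl) conflicting s ⟩
    length (pending A I s early) + s        ≡⟨ cong (λ ks → length ks + s) (filter-++ _ (block 0 s) (block s s)) ⟩
    length (pending A I s (block 0 s) ++ pending A I s (block s s)) + s
                                            ≡⟨ cong (_+ s) (length-++ (pending A I s (block 0 s))) ⟩
    length (pending A I s (block 0 s)) + length (pending A I s (block s s)) + s ∎)
    where
    open ≤-Reasoning
    early = block 0 s ++ block s s
    early-jobs : All (HasJob I (λ j → rel j ≡ 1 × dst j ≡ v2)) early
    early-jobs = All.++⁺ (All.map (has-job-map I λ { refl → refl , refl }) first-block)
                         (All.map (has-job-map I λ { refl → refl , refl }) second-block)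
    conflicting : Conflicting I early
    conflicting = common-endpoint-conflicting {I} {early} {v2} dst (λ disjoint → proj₂ (proj₂ (proj₂ disjoint)))
                    (All.map (has-job-map I proj₂) early-jobs)
    unstarted : All (λ k → ¬ CompletedBy A I k 0) early
    unstarted = All.map (λ (j , ↦j , rel≡1 , _) → unfinished-before-release {A} {I} valid ↦j (≤-reflexive (sym rel≡1)))
                        early-jobs

  late : ∀ {A b} → ValidOn A I → b + s ≤ s + s →
    All (HasJob I (λ j → src j ≡ u × rel j ≡ 1)) (block b s) →
    s ≤ 2 * length (pending A I s (block b s)) → PendingThroughout A I s
  late {A} {b} valid b+s≤s+s old-jobs s≤2p t 1+s≤t t≤ss+s =
    length (pending A I s (block b s)) , s≤2p ,
    Sustain.throughout {A} {I} valid {s} {b} {s} {s + s} {s * s} b+s≤s+s conflicting wave-release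
      (early-released (All.map (has-job-map I proj₂) old-jobs))
      t (≤-trans (n≤1+n s) 1+s≤t) (≤-trans t≤ss+s (≤-reflexive (+-comm (s * s) s)))
    where
    wave-release : ∀ {i} → i < s * s → HasJob I (λ j → rel j ≡ s + suc i) ((s + s) + i)
    wave-release i<ss = _ , wave-job i<ss , refl
    conflicting : Conflicting I (block b s ++ block (s + s) (s * s))
    conflicting = common-endpoint-conflicting {I} {block b s ++ block (s + s) (s * s)} {u} src proj₁
      (All.++⁺ (All.map (has-job-map I proj₁) old-jobs)
               (All.applyUpTo⁺₁ ((s + s) +_) (s * s) λ i<ss → _ , wave-job i<ss , refl))

-- In T1 the S2 jobs share the source v3 with S3; in T2 the S1 jobs share v1 with S4.
T1-backlogged : ∀ {s A} → ValidOn A (T1 s) → s ≤ 2 * length (pending A (T1 s) s (block s s)) →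
  PendingThroughout A (T1 s) s
T1-backlogged {s} {A} valid = Adversarial.late s v3 {A} {s} valid ≤-refl
  (All.map (has-job-map (T1 s) λ { refl → refl , refl }) (Adversarial.second-block s v3))

T2-backlogged : ∀ {s A} → ValidOn A (T2 s) → s ≤ 2 * length (pending A (T2 s) s (block 0 s)) →
  PendingThroughout A (T2 s) s
T2-backlogged {s} {A} valid = Adversarial.late s v1 {A} {0} valid (m≤n+m s s)
  (All.map (has-job-map (T2 s) λ { refl → refl , refl }) (Adversarial.first-block s v1))

at-least-half : ∀ {s a b} → s ≤ a + b → s ≤ 2 * a ⊎ s ≤ 2 * b
at-least-half {s} {a} {b} s≤a+b with ≤-total a b
... | inj₁ a≤b = inj₂ (≤-trans s≤a+b (≤-trans (+-monoˡ-≤ b a≤b) (≤-reflexive (cong (b +_) (sym (+-identityʳ b))))))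
... | inj₂ b≤a = inj₁ (≤-trans s≤a+b (≤-trans (+-monoʳ-≤ a b≤a) (≤-reflexive (cong (a +_) (sym (+-identityʳ a))))))

lemma14 : ∃[ L₀ ] ∀ (s : ℕ) → L₀ ≤ s * s → 2 ∣ s * s → (A : Alg) →
    ValidOn A (T1 s) → ValidOn A (T2 s) →
    PendingThroughout A (T1 s) s ⊎ PendingThroughout A (T2 s) s
-- The argument works for every s, so L₀ = 0.
lemma14 = 0 , λ s _ _ → backlogged s
  where
  backlogged : ∀ s A → ValidOn A (T1 s) → ValidOn A (T2 s) →
    PendingThroughout A (T1 s) s ⊎ PendingThroughout A (T2 s) s
  backlogged s A valid₁ valid₂ =
    Sum.swap (Sum.map (T2-backlogged {s} {A} valid₂) (T1-backlogged {s} {A} valid₁)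
                      (at-least-half {s} {length (pending A (T2 s) s (block 0 s))} phase₁))
    where
    -- Phase 1 in T1, with the pending S1 jobs counted in T2 (they agree up to time s).
    phase₁ : s ≤ length (pending A (T2 s) s (block 0 s)) + length (pending A (T1 s) s (block s s))
    phase₁ = subst (λ ks → s ≤ length ks + length (pending A (T1 s) s (block s s)))
                   (early-pending-agree s A ≤-refl (block 0 s)) (Adversarial.rush s v3 {A} valid₁)
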